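{- Let $\mathcal{U}$ be a coinfinite subset of $\mathcal{V}$ and let $(S,T)$ be a $\mathcal{U}$-saturated $\mathbf{GL}$-pair. If $\Box\phi\in T$, then there exist a coinfinite subset $\mathcal{U}'$ of $\mathcal{V}$ and a $\mathcal{U}'$-saturated $\mathbf{GL}$-pair $(S',T')$ such that $\mathcal{U}\subseteq\mathcal{U}'$, $\phi\in T'$, and $\Box^{ -1}S\cup\Box\Box^{ -1}S\subseteq S'$.
   Context: Formulas are those of first-order modal logic over a countable set $\mathcal{V}$ of variables, with $\top,\bot$, predicate symbols of each finite arity (no function/constant symbols), $\land,\neg,\supset$, $\forall$, and $\Box$; $\Diamond=\neg\Box\neg$ and $\Diamond^n$ is $n$-fold $\Diamond$. For a set $S$ of formulas, $\Box S=\{\Box\psi\mid\psi\in S\}$ and $\Box^{ -1}S=\{\psi\mid\Box\psi\in S\}$. $\mathsf{Var}(\phi)$ is the set of variables with a free or bound occurrence in $\phi$, and $\Phi(\mathcal{U})=\{\phi\mid\mathsf{Var}(\phi)\subseteq\mathcal{U}\}$. $\mathsf{NQGL}^-$ is the following sequent calculus (sequents $\Gamma\rightarrow\Delta$ are pairs of finite sets of formulas). Axioms: $p\rightarrow p$ ($p$ atomic), $\rightarrow\top$, $\bot\rightarrow$. Rules: weakening (from $\Gamma\rightarrow\Delta$ infer $\Gamma'\rightarrow\Delta'$ for $\Gamma\subseteq\Gamma'$, $\Delta\subseteq\Delta'$); standard LK rules for $\land$ (right: from $\Gamma\rightarrow\Delta,\phi$ and $\Gamma\rightarrow\Delta,\psi$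 infer $\Gamma\rightarrow\Delta,\phi\land\psi$; left: from $\phi,\Gamma\rightarrow\Delta$ or $\psi,\Gamma\rightarrow\Delta$ infer $\phi\land\psi,\Gamma\rightarrow\Delta$), for $\supset$ (right: from $\phi,\Gamma\rightarrow\Delta,\psi$ infer $\Gamma\rightarrow\Delta,\phi\supset\psi$; left: from $\Gamma\rightarrow\Delta,\phi$ and $\psi,\Lambda\rightarrow\Xi$ infer $\phi\supset\psi,\Gamma,\Lambda\rightarrow\Delta,\Xi$), for $\neg$ (from $\phi,\Gamma\rightarrow\Delta$ infer $\Gamma\rightarrow\Delta,\neg\phi$; from $\Gamma\rightarrow\Delta,\phi$ infer $\neg\phi,\Gamma\rightarrow\Delta$), for $\forall$ (from $\Gamma\rightarrow\Delta,\phi[y/x]$ infer $\Gamma\rightarrow\Delta,\forall x\phi$ with $y$ not occurring in the lower sequent; from $\phi[z/x],\Gamma\rightarrow\Delta$ infer $\forall x\phi,\Gamma\rightarrow\Delta$ for any $z$); (Box) from $\Box\Gamma,\Delta\rightarrow\phi$ infer $\Box\Gamma,\Box\Delta\rightarrow\Box\phi$; and (Boundedness of length) from $\Gamma\rightarrow\Delta,\Diamond^n\top$ for all $n\in\mathbb{N}$ infer $\Gamma\rightarrow\Delta$. There is no cut rule. $\vdash_{\mathsf{NQGL}^- }$ denotes derivability (derivations may be infinitary). A pair $(S,T)$ of sets of formulas is finitely consistent if $\not\vdash_{\mathsf{NQGL}^- }S'\rightarrow T'$ for all finite $S'\subseteq S$, $T'\subseteq T$. It is a $\mathbf{GL}$-pair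 if it is finitely consistent and $\Box\neg\Diamond^n\top\in S$ for some $n\in\mathbb{N}$. For $\mathcal{U}\subseteq\mathcal{V}$, a finitely consistent pair $(S,T)$ of subsets of $\Phi(\mathcal{U})$ is $\mathcal{U}$-saturated if: (1) $\phi_1\land\phi_2\in S$ implies $\phi_1,\phi_2\in S$, and $\phi_1\land\phi_2\in T$ implies $\phi_1\in T$ or $\phi_2\in T$; (2) $\phi_1\supset\phi_2\in S$ implies $\phi_1\in T$ or $\phi_2\in S$, and $\phi_1\supset\phi_2\in T$ implies $\phi_1\in S$ and $\phi_2\in T$; (3) $\neg\phi\in S$ implies $\phi\in T$, and $\neg\phi\in T$ implies $\phi\in S$; (4) $\forall x\phi\in S$ implies $\phi[z/x]\in S$ for all $z\in\mathcal{U}$, and $\forall x\phi\in T$ implies $\phi[z/x]\in T$ for some $z\in\mathcal{U}$. -}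

module Defs where

open import Level using (0ℓ)
open import Data.Nat using (ℕ; zero; suc; _≤_; _≟_)
open import Data.Vec using (Vec)
import Data.Vec as Vec
open import Data.List using (List; []; _∷_; map)
open import Data.List.Membership.Propositional using (_∈_)
open import Data.List.Relation.Unary.All using (All)
open import Data.List.Relation.Unary.Any using (Any)
open import Data.Product using (Σ; ∃; _×_; _,_)
open import Data.Sum using (_⊎_)
open import Data.Empty using (⊥)
open import Relation.Nullary using (¬_; yes; no)
open import Relation.Binary.PropositionalEquality using (_≡_)

Var : Set
Var = ℕ

infixr 6 _∧_
infixr 5 _⊃_

data Fm : Set where
  ⊤'   : Fm
  ⊥'   : Fm
  atom : (n : ℕ) → (P : ℕ) → Vec Var n → Fm
  _∧_  : Fm → Fm → Fm
  ¬'_  : Fm → Fm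
  _⊃_  : Fm → Fm → Fm
  ∀'   : Var → Fm → Fm
  □_   : Fm → Fm

data Atomic : Fm → Set where
  atomic : ∀ n P xs → Atomic (atom n P xs)

◇_ : Fm → Fm
◇ φ = ¬' (□ (¬' φ))

◇^ : ℕ → Fm → Fm
◇^ zero    φ = φ
◇^ (suc n) φ = ◇ (◇^ n φ)

data Occurs (x : Var) : Fm → Set where
  occ-atom : ∀ {n P xs} → Any (x ≡_) (Vec.toList xs) → Occurs x (atom n P xs)
  occ-∧ˡ   : ∀ {φ ψ} → Occurs x φ → Occurs x (φ ∧ ψ)
  occ-∧ʳ   : ∀ {φ ψ} → Occurs x ψ → Occurs x (φ ∧ ψ)
  occ-¬    : ∀ {φ} → Occurs x φ → Occurs x (¬' φ)
  occ-⊃ˡ   : ∀ {φ ψ} → Occurs x φ → Occurs x (φ ⊃ ψ)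
  occ-⊃ʳ   : ∀ {φ ψ} → Occurs x ψ → Occurs x (φ ⊃ ψ)
  occ-∀b   : ∀ {φ} → Occurs x (∀' x φ)
  occ-∀    : ∀ {y φ} → Occurs x φ → Occurs x (∀' y φ)
  occ-□    : ∀ {φ} → Occurs x φ → Occurs x (□ φ)

OccursL : Var → List Fm → Set
OccursL x Γ = Any (Occurs x) Γ

renVar : Var → Var → Var → Var
renVar y x z with z ≟ x
... | yes _ = y
... | no  _ = z

_[_/_] : Fm → Var → Var → Fm
⊤'             [ y / x ] = ⊤'
⊥'             [ y / x ] = ⊥'
atom n P xs    [ y / x ] = atom n P (Vec.map (renVar y x) xs)
(φ ∧ ψ)        [ y / x ] = (φ [ y / x ]) ∧ (ψ [ y / x ])
(¬' φ)         [ y / x ] = ¬' (φ [ y / x ])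
(φ ⊃ ψ)        [ y / x ] = (φ [ y / x ]) ⊃ (ψ [ y / x ])
(∀' z φ)       [ y / x ] with z ≟ x
... | yes _ = ∀' z φ
... | no  _ = ∀' z (φ [ y / x ])
(□ φ)          [ y / x ] = □ (φ [ y / x ])

-- The sequent calculus NQGL⁻ (finite sets represented by lists; the
-- weakening rule uses membership inclusion, so order/multiplicity are
-- irrelevant). Derivations are infinitary (rule bl).

_⊆L_ : List Fm → List Fm → Set
Γ ⊆L Γ' = ∀ {φ} → φ ∈ Γ → φ ∈ Γ'

infixr 5 _++_
_++_ : List Fm → List Fm → List Fm
[]      ++ ys = ys
(x ∷ xs) ++ ys = x ∷ (xs ++ ys)

infix 3 _⇒_
data _⇒_ : List Fm → List Fm → Set where
  ax    : ∀ {p} → Atomic p → (p ∷ []) ⇒ (p ∷ [])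
  ax⊤   : [] ⇒ (⊤' ∷ [])
  ax⊥   : (⊥' ∷ []) ⇒ []
  wk    : ∀ {Γ Δ Γ' Δ'} → Γ ⊆L Γ' → Δ ⊆L Δ' → Γ ⇒ Δ → Γ' ⇒ Δ'
  ∧R    : ∀ {Γ Δ φ ψ} → Γ ⇒ φ ∷ Δ → Γ ⇒ ψ ∷ Δ → Γ ⇒ (φ ∧ ψ) ∷ Δ
  ∧L₁   : ∀ {Γ Δ φ ψ} → φ ∷ Γ ⇒ Δ → (φ ∧ ψ) ∷ Γ ⇒ Δ
  ∧L₂   : ∀ {Γ Δ φ ψ} → ψ ∷ Γ ⇒ Δ → (φ ∧ ψ) ∷ Γ ⇒ Δ
  ⊃R    : ∀ {Γ Δ φ ψ} → φ ∷ Γ ⇒ ψ ∷ Δ → Γ ⇒ (φ ⊃ ψ) ∷ Δ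
  ⊃L    : ∀ {Γ Δ Λ Ξ φ ψ} → Γ ⇒ φ ∷ Δ → ψ ∷ Λ ⇒ Ξ →
          (φ ⊃ ψ) ∷ (Γ ++ Λ) ⇒ Δ ++ Ξ
  ¬R    : ∀ {Γ Δ φ} → φ ∷ Γ ⇒ Δ → Γ ⇒ (¬' φ) ∷ Δ
  ¬L    : ∀ {Γ Δ φ} → Γ ⇒ φ ∷ Δ → (¬' φ) ∷ Γ ⇒ Δ
  ∀R    : ∀ {Γ Δ x y φ} →
          ¬ OccursL y Γ → ¬ OccursL y Δ → ¬ Occurs y (∀' x φ) →
          Γ ⇒ (φ [ y / x ]) ∷ Δ → Γ ⇒ (∀' x φ) ∷ Δ
  ∀L    : ∀ {Γ Δ x z φ} → (φ [ z / x ]) ∷ Γ ⇒ Δ → (∀' x φ) ∷ Γ ⇒ Δ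
  box   : ∀ {Γ Δ φ} → map □_ Γ ++ Δ ⇒ φ ∷ [] →
          map □_ Γ ++ map □_ Δ ⇒ (□ φ) ∷ []
  bl    : ∀ {Γ Δ} → ((n : ℕ) → Γ ⇒ (◇^ n ⊤') ∷ Δ) → Γ ⇒ Δ

FmSet : Set₁
FmSet = Fm → Set

VarSet : Set₁
VarSet = Var → Set

Coinfinite : VarSet → Set
Coinfinite U = ∀ n → ∃ λ m → n ≤ m × ¬ U m

InΦ : VarSet → Fm → Set
InΦ U φ = ∀ x → Occurs x φ → U x

FinitelyConsistent : FmSet → FmSet → Set
FinitelyConsistent S T =
  ∀ (S' T' : List Fm) → All S S' → All T T' → ¬ (S' ⇒ T')

GLPair : FmSet → FmSet → Set
GLPair S T = FinitelyConsistent S T × ∃ λ n → S (□ (¬' (◇^ n ⊤')))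

record Saturated (U : VarSet) (S T : FmSet) : Set where
  field
    consistent : FinitelyConsistent S T
    S⊆Φ        : ∀ φ → S φ → InΦ U φ
    T⊆Φ        : ∀ φ → T φ → InΦ U φ
    ∧S         : ∀ φ₁ φ₂ → S (φ₁ ∧ φ₂) → S φ₁ × S φ₂
    ∧T         : ∀ φ₁ φ₂ → T (φ₁ ∧ φ₂) → T φ₁ ⊎ T φ₂
    ⊃S         : ∀ φ₁ φ₂ → S (φ₁ ⊃ φ₂) → T φ₁ ⊎ S φ₂
    ⊃T         : ∀ φ₁ φ₂ → T (φ₁ ⊃ φ₂) → S φ₁ × T φ₂
    ¬S         : ∀ φ → S (¬' φ) → T φ
    ¬T         : ∀ φ → T (¬' φ) → S φ
    ∀S         : ∀ x φ → S (∀' x φ) → ∀ z → U z → S (φ [ z / x ])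
    ∀T         : ∀ x φ → T (∀' x φ) → ∃ λ z → U z × T (φ [ z / x ])

-- The pair (□⁻¹S ∪ □□⁻¹S, {φ}) is consistent: a refutation of it becomes, by the box rule,
-- a refutation of (S, {□φ}). It contains □¬◇ⁿ⊤, so every consistent pair above it is a GL-pair.
-- Extend it along a chain of consistent pairs driven by an enumeration that visits every formula
-- infinitely often. At stage k the k-th formula is decomposed on the side where it occurs: on the
-- left ∀ receives all instances over the variables used so far, on the right it receives one
-- instance at a fresh variable (so ∀R applies), and for the branching rules (⊃ on the left,
-- ∧ on the right) excluded middle picks a consistent branch, since two refutations would combine
-- by the rule into a refutation of the previous stage. The union of the chain is saturated, and
-- fresh variables are drawn from every other element of the complement of U, so U' stays
-- coinfinite.
module Submission where

open import Defs
open import Level using (0ℓ)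
open import Axiom.ExcludedMiddle using (ExcludedMiddle)
open import Data.Nat using (ℕ; zero; suc; _≟_; _*_; _+_; _≤_; _<_; _⊔_; z≤n; s≤s; _≤′_; ≤′-refl; ≤′-step)
open import Data.Nat.Properties
open import Data.Vec using (Vec; []; _∷_)
import Data.Vec as Vec
open import Data.List using (List; []; _∷_; map)
import Data.List as List
open import Data.List.Membership.Propositional using (_∈_)
import Data.List.Membership.Propositional.Properties as ∈
open import Data.List.Relation.Binary.Subset.Propositional.Properties using (⊆-refl; ∷⁺ʳ; xs⊆x∷xs; ∈-∷⁺ʳ)
open import Data.List.Relation.Unary.All as All using (All; []; _∷_)
open import Data.List.Relation.Unary.All.Properties using (All¬⇒¬Any; ++⁺; map⁺)
open import Data.List.Relation.Unary.Any using (Any; here; there)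
open import Data.Product using (Σ; ∃; ∃₂; _×_; _,_; proj₁; proj₂; uncurry; map₂)
open import Data.Sum using (_⊎_; inj₁; inj₂; [_,_]′)
import Data.Sum as Sum
open import Data.Empty using (⊥-elim)
open import Data.Unit using (⊤; tt)
open import Function using (_∘_; const)
open import Relation.Nullary using (¬_; yes; no)
open import Relation.Unary using (_⊆_; _∪_; ∅; ｛_｝; ⋃)
open import Relation.Binary using (tri<; tri≈; tri>)
open import Relation.Binary.PropositionalEquality
  using (_≡_; refl; sym; cong; cong₂; subst; subst₂; module ≡-Reasoning)

-- unpair enumerates ℕ × ℕ along the anti-diagonals.
next : ℕ × ℕ → ℕ × ℕ
next (zero  , b) = suc b , zero
next (suc a , b) = a , suc b

unpair : ℕ → ℕ × ℕ
unpair zero    = zero , zero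
unpair (suc k) = next (unpair k)

unpair-walk : ∀ b {a c k} → unpair k ≡ (b + a , c) → unpair (b + k) ≡ (a , b + c)
unpair-walk zero    eq = eq
unpair-walk (suc b) {a} {c} {k} eq =
  subst₂ (λ i j → unpair i ≡ (a , j)) (+-suc b k) (+-suc b c) (unpair-walk b (cong next eq))

unpair-walk₀ : ∀ b {a k} → unpair k ≡ (b + a , 0) → unpair (b + k) ≡ (a , b)
unpair-walk₀ b {a} {k} eq = subst (λ j → unpair (b + k) ≡ (a , j)) (+-identityʳ b) (unpair-walk b eq)

unpair-diagonal : ∀ s → ∃ λ k → unpair k ≡ (s , 0)
unpair-diagonal zero = 0 , refl
unpair-diagonal (suc s) with unpair-diagonal s
... | k , eq =
  suc (s + k) , cong next (unpair-walk₀ s (subst (λ i → unpair k ≡ (i , 0)) (sym (+-identityʳ s)) eq))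

unpair-surjective : ∀ a b → ∃ λ k → unpair k ≡ (a , b)
unpair-surjective a b with unpair-diagonal (b + a)
... | k , eq = b + k , unpair-walk₀ b eq

pair : ℕ → ℕ → ℕ
pair a b = proj₁ (unpair-surjective a b)

unpair-pair : ∀ a b → unpair (pair a b) ≡ (a , b)
unpair-pair a b = proj₂ (unpair-surjective a b)

unpair₂-≤ : ∀ k → proj₂ (unpair k) ≤ k
unpair₂-≤ zero    = z≤n
unpair₂-≤ (suc k) = next₂-≤ (unpair k) (unpair₂-≤ k)
  where
  next₂-≤ : ∀ p → proj₂ p ≤ k → proj₂ (next p) ≤ suc k
  next₂-≤ (zero  , _) _  = z≤n
  next₂-≤ (suc _ , _) le = s≤s le

encodeVec : ∀ {n} → Vec ℕ n → ℕ
encodeVec []       = 0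
encodeVec (x ∷ xs) = pair x (encodeVec xs)

decodeVec : ∀ n → ℕ → Vec ℕ n
decodeVec zero    _ = []
decodeVec (suc n) c = proj₁ (unpair c) ∷ decodeVec n (proj₂ (unpair c))

decodeVec-encodeVec : ∀ {n} (xs : Vec ℕ n) → decodeVec n (encodeVec xs) ≡ xs
decodeVec-encodeVec []       = refl
decodeVec-encodeVec (x ∷ xs) rewrite unpair-pair x (encodeVec xs) = cong (x ∷_) (decodeVec-encodeVec xs)

encode : Fm → ℕ
encode ⊤'            = pair 0 0
encode ⊥'            = pair 1 0
encode (atom n P xs) = pair 2 (pair n (pair P (encodeVec xs)))
encode (φ ∧ ψ)       = pair 3 (pair (encode φ) (encode ψ))
encode (¬' φ)        = pair 4 (encode φ)
encode (φ ⊃ ψ)       = pair 5 (pair (encode φ) (encode ψ))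
encode (∀' x φ)      = pair 6 (pair x (encode φ))
encode (□ φ)         = pair 7 (encode φ)

depth : Fm → ℕ
depth (φ ∧ ψ)  = suc (depth φ ⊔ depth ψ)
depth (¬' φ)   = suc (depth φ)
depth (φ ⊃ ψ)  = suc (depth φ ⊔ depth ψ)
depth (∀' _ φ) = suc (depth φ)
depth (□ φ)    = suc (depth φ)
depth _        = 1

-- The first argument is fuel bounding the depth of the decoded formula; junk codes decode to ⊤'.
mutual
  decode : ℕ → ℕ → Fm
  decode zero    _ = ⊤'
  decode (suc f) c = decodeNode f (unpair c)

  decodeNode : ℕ → ℕ × ℕ → Fm
  decodeNode f (1 , _) = ⊥'
  decodeNode f (2 , r) = decodeAtom (unpair r)
  decodeNode f (3 , r) = decode f (proj₁ (unpair r)) ∧ decode f (proj₂ (unpair r))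
  decodeNode f (4 , r) = ¬' decode f r
  decodeNode f (5 , r) = decode f (proj₁ (unpair r)) ⊃ decode f (proj₂ (unpair r))
  decodeNode f (6 , r) = ∀' (proj₁ (unpair r)) (decode f (proj₂ (unpair r)))
  decodeNode f (7 , r) = □ decode f r
  decodeNode f _       = ⊤'

  decodeAtom : ℕ × ℕ → Fm
  decodeAtom (n , r) = atom n (proj₁ (unpair r)) (decodeVec n (proj₂ (unpair r)))

decode-encode : ∀ φ {f} → depth φ ≤ f → decode f (encode φ) ≡ φ
decode-encode ⊤' {suc f} _ rewrite unpair-pair 0 0 = refl
decode-encode ⊥' {suc f} _ rewrite unpair-pair 1 0 = refl
decode-encode (atom n P xs) {suc f} _
  rewrite unpair-pair 2 (pair n (pair P (encodeVec xs))) | unpair-pair n (pair P (encodeVec xs))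
        | unpair-pair P (encodeVec xs) = cong (atom n P) (decodeVec-encodeVec xs)
decode-encode (φ ∧ ψ) {suc f} (s≤s d)
  rewrite unpair-pair 3 (pair (encode φ) (encode ψ)) | unpair-pair (encode φ) (encode ψ) =
  cong₂ _∧_ (decode-encode φ (m⊔n≤o⇒m≤o _ _ d)) (decode-encode ψ (m⊔n≤o⇒n≤o _ _ d))
decode-encode (¬' φ) {suc f} (s≤s d) rewrite unpair-pair 4 (encode φ) = cong ¬'_ (decode-encode φ d)
decode-encode (φ ⊃ ψ) {suc f} (s≤s d)
  rewrite unpair-pair 5 (pair (encode φ) (encode ψ)) | unpair-pair (encode φ) (encode ψ) =
  cong₂ _⊃_ (decode-encode φ (m⊔n≤o⇒m≤o _ _ d)) (decode-encode ψ (m⊔n≤o⇒n≤o _ _ d))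
decode-encode (∀' x φ) {suc f} (s≤s d)
  rewrite unpair-pair 6 (pair x (encode φ)) | unpair-pair x (encode φ) = cong (∀' x) (decode-encode φ d)
decode-encode (□ φ) {suc f} (s≤s d) rewrite unpair-pair 7 (encode φ) = cong □_ (decode-encode φ d)

formulaAt : ℕ → Fm
formulaAt k = uncurry decode (unpair (proj₁ (unpair k)))

formulaAt-recurrent : ∀ φ n → ∃ λ k → n ≤ k × formulaAt k ≡ φ
formulaAt-recurrent φ n = k , subst (_≤ k) (cong proj₂ k-unpairs) (unpair₂-≤ k) , k-decodes
  where
  open ≡-Reasoning
  code k : ℕ
  code = pair (depth φ) (encode φ)
  k    = pair code n
  k-unpairs : unpair k ≡ (code , n)
  k-unpairs = unpair-pair code n
  k-decodes : formulaAt k ≡ φ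
  k-decodes = begin
    uncurry decode (unpair (proj₁ (unpair k))) ≡⟨ cong (uncurry decode ∘ unpair ∘ proj₁) k-unpairs ⟩
    uncurry decode (unpair code)               ≡⟨ cong (uncurry decode) (unpair-pair (depth φ) (encode φ)) ⟩
    decode (depth φ) (encode φ)                ≡⟨ decode-encode φ ≤-refl ⟩
    φ                                          ∎

module _ {U : VarSet} (co : Coinfinite U) where

  avoid : ℕ → Var
  avoid zero    = proj₁ (co 0)
  avoid (suc k) = proj₁ (co (suc (avoid k)))

  avoid-∉ : ∀ k → ¬ U (avoid k)
  avoid-∉ zero    = proj₂ (proj₂ (co 0))
  avoid-∉ (suc k) = proj₂ (proj₂ (co (suc (avoid k))))

  avoid-<-suc : ∀ k → avoid k < avoid (suc k)
  avoid-<-suc k = proj₁ (proj₂ (co (suc (avoid k))))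

  avoid-≥ : ∀ k → k ≤ avoid k
  avoid-≥ zero    = z≤n
  avoid-≥ (suc k) = ≤-trans (s≤s (avoid-≥ k)) (avoid-<-suc k)

  avoid-< : ∀ {i j} → i < j → avoid i < avoid j
  avoid-< = avoid-<′ ∘ ≤⇒≤′
    where
    avoid-<′ : ∀ {i j} → suc i ≤′ j → avoid i < avoid j
    avoid-<′ {i} ≤′-refl           = avoid-<-suc i
    avoid-<′ (≤′-step {j} i<j) = <-trans (avoid-<′ i<j) (avoid-<-suc j)

  avoid-injective : ∀ {i j} → avoid i ≡ avoid j → i ≡ j
  avoid-injective {i} {j} eq with <-cmp i j
  ... | tri< i<j _ _ = ⊥-elim (<⇒≢ (avoid-< i<j) eq)
  ... | tri≈ _ i≡j _ = i≡j
  ... | tri> _ _ j<i = ⊥-elim (<⇒≢ (avoid-< j<i) (sym eq))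

InΦ-mono : ∀ {V W φ} → V ⊆ W → InΦ V φ → InΦ W φ
InΦ-mono V⊆W h x o = V⊆W (h x o)

InΦ-sub : ∀ {V φ ψ} → (∀ {x} → Occurs x φ → Occurs x ψ) → InΦ V ψ → InΦ V φ
InΦ-sub sub h x o = h x (sub o)

occurs-renVar : ∀ {w y x n} (xs : Vec Var n) →
  Any (w ≡_) (Vec.toList (Vec.map (renVar y x) xs)) → Any (w ≡_) (Vec.toList xs) ⊎ w ≡ y
occurs-renVar {x = x} (z ∷ _) (here eq) with z ≟ x
... | yes _ = inj₂ eq
... | no  _ = inj₁ (here eq)
occurs-renVar (_ ∷ xs) (there m) = Sum.map₁ there (occurs-renVar xs m)

occurs-[/] : ∀ {w y x} φ → Occurs w (φ [ y / x ]) → Occurs w φ ⊎ w ≡ y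
occurs-[/] (atom n P xs) (occ-atom m) = Sum.map₁ occ-atom (occurs-renVar xs m)
occurs-[/] (φ ∧ ψ) (occ-∧ˡ o) = Sum.map₁ occ-∧ˡ (occurs-[/] φ o)
occurs-[/] (φ ∧ ψ) (occ-∧ʳ o) = Sum.map₁ occ-∧ʳ (occurs-[/] ψ o)
occurs-[/] (¬' φ) (occ-¬ o) = Sum.map₁ occ-¬ (occurs-[/] φ o)
occurs-[/] (φ ⊃ ψ) (occ-⊃ˡ o) = Sum.map₁ occ-⊃ˡ (occurs-[/] φ o)
occurs-[/] (φ ⊃ ψ) (occ-⊃ʳ o) = Sum.map₁ occ-⊃ʳ (occurs-[/] ψ o)
occurs-[/] {x = x} (∀' z φ) o with z ≟ x
... | yes _ = inj₁ o
occurs-[/] (∀' z φ) occ-∀b    | no _ = inj₁ occ-∀b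
occurs-[/] (∀' z φ) (occ-∀ o) | no _ = Sum.map₁ occ-∀ (occurs-[/] φ o)
occurs-[/] (□ φ) (occ-□ o) = Sum.map₁ occ-□ (occurs-[/] φ o)

InΦ-instance : ∀ {V x y φ} → InΦ V (∀' x φ) → V y → InΦ V (φ [ y / x ])
InΦ-instance {V} {φ = φ} h Vy w o = [ h w ∘ occ-∀ , (λ w≡y → subst V (sym w≡y) Vy) ]′ (occurs-[/] φ o)

FreshFor : Var → FmSet → Set
FreshFor y A = ∀ {φ} → A φ → ¬ Occurs y φ

fresh-outside : ∀ {V y A} → A ⊆ InΦ V → ¬ V y → FreshFor y A
fresh-outside A⊆Φ ¬Vy a o = ¬Vy (A⊆Φ a _ o)

-- Defs has its own _++_ on sequents; the library's lemmas about List._++_ are transported along ++-≡.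
++-≡ : ∀ (Γ Δ : List Fm) → Γ ++ Δ ≡ Γ List.++ Δ
++-≡ []      Δ = refl
++-≡ (φ ∷ Γ) Δ = cong (φ ∷_) (++-≡ Γ Δ)

∈-++⁺ˡ : ∀ {φ Γ Δ} → φ ∈ Γ → φ ∈ Γ ++ Δ
∈-++⁺ˡ {φ} {Γ} {Δ} m = subst (φ ∈_) (sym (++-≡ Γ Δ)) (∈.∈-++⁺ˡ m)

∈-++⁺ʳ : ∀ {φ Δ} Γ → φ ∈ Δ → φ ∈ Γ ++ Δ
∈-++⁺ʳ {φ} {Δ} Γ m = subst (φ ∈_) (sym (++-≡ Γ Δ)) (∈.∈-++⁺ʳ Γ m)

∈-++⁻ : ∀ {φ Δ} Γ → φ ∈ Γ ++ Δ → φ ∈ Γ ⊎ φ ∈ Δ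
∈-++⁻ {φ} {Δ} Γ m = ∈.∈-++⁻ Γ (subst (φ ∈_) (++-≡ Γ Δ) m)

++-⊆ : ∀ {Γ Γ' Δ Δ'} → Γ ⊆L Γ' → Δ ⊆L Δ' → (Γ ++ Δ) ⊆L (Γ' ++ Δ')
++-⊆ {Γ} {Γ'} Γ⊆ Δ⊆ m = [ ∈-++⁺ˡ ∘ Γ⊆ , ∈-++⁺ʳ Γ' ∘ Δ⊆ ]′ (∈-++⁻ Γ m)

All-++ : ∀ {P : FmSet} {Γ Δ} → All P Γ → All P Δ → All P (Γ ++ Δ)
All-++ {P} {Γ} {Δ} pΓ pΔ = subst (All P) (sym (++-≡ Γ Δ)) (++⁺ pΓ pΔ)

partition-∪ : ∀ {P Q : FmSet} Λ → All (P ∪ Q) Λ → ∃₂ λ Γ X → All P Γ × All Q X × Λ ⊆L (X ++ Γ)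
partition-∪ []      []         = [] , [] , [] , [] , λ ()
partition-∪ (φ ∷ Λ) (pq ∷ pqs) with partition-∪ Λ pqs | pq
... | Γ , X , pΓ , qX , Λ⊆ | inj₁ p =
  φ ∷ Γ , X , p ∷ pΓ , qX , ∈-∷⁺ʳ (∈-++⁺ʳ X (here refl)) (++-⊆ ⊆-refl (xs⊆x∷xs _ φ) ∘ Λ⊆)
... | Γ , X , pΓ , qX , Λ⊆ | inj₂ q = Γ , φ ∷ X , pΓ , q ∷ qX , ∷⁺ʳ φ Λ⊆

Instances : Var → Fm → VarSet → FmSet
Instances x φ V χ = ∃ λ z → V z × χ ≡ φ [ z / x ]

InconsistentWith : FmSet → FmSet → List Fm → List Fm → Set
InconsistentWith S T L M = ∃₂ λ Γ Δ → All S Γ × All T Δ × (L ++ Γ) ⇒ (M ++ Δ)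

Inconsistent : FmSet → FmSet → Set
Inconsistent S T = InconsistentWith S T [] []

¬inconsistent : ∀ {S T} → FinitelyConsistent S T → ¬ Inconsistent S T
¬inconsistent fc (Γ , Δ , sΓ , tΔ , d) = fc Γ Δ sΓ tΔ d

inconsistent-∪ : ∀ {S T} L M → Inconsistent (S ∪ (_∈ L)) (T ∪ (_∈ M)) → InconsistentWith S T L M
inconsistent-∪ L M (Λ , Ξ , aΛ , aΞ , d) with partition-∪ Λ aΛ | partition-∪ Ξ aΞ
... | Γ , X , sΓ , X⊆L , Λ⊆ | Δ , Y , tΔ , Y⊆M , Ξ⊆ =
  Γ , Δ , sΓ , tΔ , wk (++-⊆ (All.lookup X⊆L) ⊆-refl ∘ Λ⊆) (++-⊆ (All.lookup Y⊆M) ⊆-refl ∘ Ξ⊆) d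

∧L-inconsistent : ∀ {S T φ ψ} → S (φ ∧ ψ) → InconsistentWith S T (φ ∷ ψ ∷ []) [] → Inconsistent S T
∧L-inconsistent s (Γ , Δ , sΓ , tΔ , d) =
  _ , Δ , s ∷ s ∷ sΓ , tΔ , ∧L₁ (wk swap ⊆-refl (∧L₂ (wk swap ⊆-refl d)))
  where
  swap : ∀ {φ ψ Γ} → (φ ∷ ψ ∷ Γ) ⊆L (ψ ∷ φ ∷ Γ)
  swap (here eq)         = there (here eq)
  swap (there (here eq)) = here eq
  swap (there (there m)) = there (there m)

¬L-inconsistent : ∀ {S T φ} → S (¬' φ) → InconsistentWith S T [] (φ ∷ []) → Inconsistent S T
¬L-inconsistent s (Γ , Δ , sΓ , tΔ , d) = _ , Δ , s ∷ sΓ , tΔ , ¬L d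

⊃L-inconsistent : ∀ {S T φ ψ} → S (φ ⊃ ψ) →
  InconsistentWith S T [] (φ ∷ []) → InconsistentWith S T (ψ ∷ []) [] → Inconsistent S T
⊃L-inconsistent s (Γ₁ , Δ₁ , sΓ₁ , tΔ₁ , d₁) (Γ₂ , Δ₂ , sΓ₂ , tΔ₂ , d₂) =
  _ , _ , s ∷ All-++ sΓ₁ sΓ₂ , All-++ tΔ₁ tΔ₂ , ⊃L d₁ d₂

∀L-instances : ∀ {x φ V Γ Δ} X → All (Instances x φ V) X → ∀' x φ ∈ Γ → (X ++ Γ) ⇒ Δ → Γ ⇒ Δ
∀L-instances []      []                    _   d = d
∀L-instances (_ ∷ X) ((z , _ , refl) ∷ insts) ∀∈Γ d =
  ∀L-instances X insts ∀∈Γ (wk (∈-∷⁺ʳ (∈-++⁺ʳ X ∀∈Γ) ⊆-refl) ⊆-refl (∀L {z = z} d))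

∀L-inconsistent : ∀ {S T x φ V} → S (∀' x φ) →
  Inconsistent (S ∪ Instances x φ V) (T ∪ ∅) → Inconsistent S T
∀L-inconsistent {x = x} {φ} s (Λ , Ξ , aΛ , aΞ , d) with partition-∪ Λ aΛ
... | Γ , X , sΓ , insts , Λ⊆ =
  ∀' x φ ∷ Γ , Ξ , s ∷ sΓ , All.map [ (λ t → t) , ⊥-elim ]′ aΞ ,
  ∀L-instances X insts (here refl) (wk (++-⊆ ⊆-refl (xs⊆x∷xs _ _) ∘ Λ⊆) ⊆-refl d)

∧R-inconsistent : ∀ {S T φ ψ} → T (φ ∧ ψ) →
  InconsistentWith S T [] (φ ∷ []) → InconsistentWith S T [] (ψ ∷ []) → Inconsistent S T
∧R-inconsistent t (Γ₁ , Δ₁ , sΓ₁ , tΔ₁ , d₁) (Γ₂ , Δ₂ , sΓ₂ , tΔ₂ , d₂) =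
  Γ₁ ++ Γ₂ , _ , All-++ sΓ₁ sΓ₂ , t ∷ All-++ tΔ₁ tΔ₂ ,
  ∧R (wk ∈-++⁺ˡ (∷⁺ʳ _ ∈-++⁺ˡ) d₁) (wk (∈-++⁺ʳ Γ₁) (∷⁺ʳ _ (∈-++⁺ʳ Δ₁)) d₂)

¬R-inconsistent : ∀ {S T φ} → T (¬' φ) → InconsistentWith S T (φ ∷ []) [] → Inconsistent S T
¬R-inconsistent t (Γ , Δ , sΓ , tΔ , d) = Γ , _ , sΓ , t ∷ tΔ , ¬R d

⊃R-inconsistent : ∀ {S T φ ψ} → T (φ ⊃ ψ) → InconsistentWith S T (φ ∷ []) (ψ ∷ []) → Inconsistent S T
⊃R-inconsistent t (Γ , Δ , sΓ , tΔ , d) = Γ , _ , sΓ , t ∷ tΔ , ⊃R d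

∀R-inconsistent : ∀ {S T x φ y} → FreshFor y S → FreshFor y T → T (∀' x φ) →
  InconsistentWith S T [] (φ [ y / x ] ∷ []) → Inconsistent S T
∀R-inconsistent {y = y} freshS freshT t (Γ , Δ , sΓ , tΔ , d) =
  Γ , _ , sΓ , t ∷ tΔ ,
  ∀R {y = y} (All¬⇒¬Any (All.map freshS sΓ)) (All¬⇒¬Any (All.map freshT tΔ)) (freshT t) d

record Stage (V : VarSet) : Set₁ where
  field
    S T        : FmSet
    consistent : FinitelyConsistent S T
    S⊆Φ        : S ⊆ InΦ V
    T⊆Φ        : T ⊆ InΦ V

open Stage

record _⊑_ {V W} (p : Stage V) (q : Stage W) : Set where
  constructor ⊑-intro
  field
    S-⊆ : S p ⊆ S q
    T-⊆ : T p ⊆ T q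

open _⊑_

⊑-refl : ∀ {V} {p : Stage V} → p ⊑ p
⊑-refl = ⊑-intro (λ s → s) (λ t → t)

⊑-trans : ∀ {V W X} {p : Stage V} {q : Stage W} {r : Stage X} → p ⊑ q → q ⊑ r → p ⊑ r
⊑-trans (⊑-intro s₁ t₁) (⊑-intro s₂ t₂) = ⊑-intro (s₂ ∘ s₁) (t₂ ∘ t₁)

weaken : ∀ {V W} → V ⊆ W → Stage V → Stage W
weaken V⊆W p = record
  { S = S p ; T = T p ; consistent = consistent p
  ; S⊆Φ = InΦ-mono V⊆W ∘ S⊆Φ p ; T⊆Φ = InΦ-mono V⊆W ∘ T⊆Φ p }

⊑-weaken : ∀ {V W} (V⊆W : V ⊆ W) (p : Stage V) → p ⊑ weaken V⊆W p
⊑-weaken _ _ = ⊑-intro (λ s → s) (λ t → t)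

refute : ∀ {V} {X : Set} (p : Stage V) → (X → Inconsistent (S p) (T p)) → ¬ X
refute p reduce = ¬inconsistent (consistent p) ∘ reduce

extend : ∀ {V} (p : Stage V) {A B : FmSet} → A ⊆ InΦ V → B ⊆ InΦ V →
  ¬ Inconsistent (S p ∪ A) (T p ∪ B) →
  Σ (Stage V) λ q → p ⊑ q × A ⊆ S q × B ⊆ T q
extend p {A} {B} A⊆Φ B⊆Φ ¬i = q , ⊑-intro inj₁ inj₁ , inj₂ , inj₂
  where
  q : Stage _
  q = record
    { S = S p ∪ A ; T = T p ∪ B
    ; consistent = λ Γ Δ sΓ tΔ d → ¬i (Γ , Δ , sΓ , tΔ , d)
    ; S⊆Φ = [ S⊆Φ p , A⊆Φ ]′ ; T⊆Φ = [ T⊆Φ p , B⊆Φ ]′ }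

extendWith : ∀ {V} (p : Stage V) L M → All (InΦ V) L → All (InΦ V) M →
  ¬ InconsistentWith (S p) (T p) L M →
  Σ (Stage V) λ q → p ⊑ q × All (S q) L × All (T q) M
extendWith p L M L⊆Φ M⊆Φ ¬i =
  map₂ (map₂ λ (L⊆ , M⊆) → All.tabulate L⊆ , All.tabulate M⊆)
       (extend p (All.lookup L⊆Φ) (All.lookup M⊆Φ) (¬i ∘ inconsistent-∪ L M))

SClosed : VarSet → FmSet → FmSet → Fm → Set
SClosed V S T (φ ∧ ψ)  = S φ × S ψ
SClosed V S T (¬' φ)   = T φ
SClosed V S T (φ ⊃ ψ)  = T φ ⊎ S ψ
SClosed V S T (∀' x φ) = ∀ z → V z → S (φ [ z / x ])
SClosed V S T _        = ⊤

TClosed : Var → FmSet → FmSet → Fm → Set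
TClosed y S T (φ ∧ ψ)  = T φ ⊎ T ψ
TClosed y S T (¬' φ)   = S φ
TClosed y S T (φ ⊃ ψ)  = S φ × T ψ
TClosed y S T (∀' x φ) = T (φ [ y / x ])
TClosed y S T _        = ⊤

SClosed-mono : ∀ ψ {V V' S S' T T'} → V' ⊆ V → S ⊆ S' → T ⊆ T' → SClosed V S T ψ → SClosed V' S' T' ψ
SClosed-mono (φ ∧ ψ)  _   S⊆ _  (sφ , sψ) = S⊆ sφ , S⊆ sψ
SClosed-mono (¬' φ)   _   _  T⊆ tφ        = T⊆ tφ
SClosed-mono (φ ⊃ ψ)  _   S⊆ T⊆ c         = Sum.map T⊆ S⊆ c
SClosed-mono (∀' x φ) V'⊆ S⊆ _  c         = λ z V'z → S⊆ (c z (V'⊆ V'z))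
SClosed-mono ⊤'            _ _ _ c = c
SClosed-mono ⊥'            _ _ _ c = c
SClosed-mono (atom _ _ _)  _ _ _ c = c
SClosed-mono (□ _)         _ _ _ c = c

TClosed-mono : ∀ ψ {y S S' T T'} → S ⊆ S' → T ⊆ T' → TClosed y S T ψ → TClosed y S' T' ψ
TClosed-mono (φ ∧ ψ)  _  T⊆ c         = Sum.map T⊆ T⊆ c
TClosed-mono (¬' φ)   S⊆ _  sφ        = S⊆ sφ
TClosed-mono (φ ⊃ ψ)  S⊆ T⊆ (sφ , tψ) = S⊆ sφ , T⊆ tψ
TClosed-mono (∀' x φ) _  T⊆ t         = T⊆ t
TClosed-mono ⊤'            _ _ c = c
TClosed-mono ⊥'            _ _ c = c
TClosed-mono (atom _ _ _)  _ _ c = c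
TClosed-mono (□ _)         _ _ c = c

Processes : ∀ {V W} → Var → Fm → Stage V → Stage W → Set
Processes {V} y ψ p q =
  p ⊑ q × (S p ψ → SClosed V (S q) (T q) ψ) × (T p ψ → TClosed y (S q) (T q) ψ)

module _ (em : ExcludedMiddle 0ℓ) where

  extend-either : ∀ {V} (p : Stage V) L₁ M₁ L₂ M₂ →
    All (InΦ V) L₁ → All (InΦ V) M₁ → All (InΦ V) L₂ → All (InΦ V) M₂ →
    (InconsistentWith (S p) (T p) L₁ M₁ → InconsistentWith (S p) (T p) L₂ M₂ → Inconsistent (S p) (T p)) →
    Σ (Stage V) λ q → p ⊑ q × (All (S q) L₁ × All (T q) M₁ ⊎ All (S q) L₂ × All (T q) M₂)
  extend-either p L₁ M₁ L₂ M₂ L₁⊆Φ M₁⊆Φ L₂⊆Φ M₂⊆Φ combine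
    with em {InconsistentWith (S p) (T p) L₁ M₁}
  ... | no ¬i₁ = map₂ (map₂ inj₁) (extendWith p L₁ M₁ L₁⊆Φ M₁⊆Φ ¬i₁)
  ... | yes i₁ = map₂ (map₂ inj₂) (extendWith p L₂ M₂ L₂⊆Φ M₂⊆Φ (refute p (combine i₁)))

  extendS : ∀ ψ {V} (p : Stage V) → S p ψ → Σ (Stage V) λ q → p ⊑ q × SClosed V (S q) (T q) ψ
  extendS (φ ∧ ψ) p s
    with extendWith p (φ ∷ ψ ∷ []) [] (InΦ-sub occ-∧ˡ (S⊆Φ p s) ∷ InΦ-sub occ-∧ʳ (S⊆Φ p s) ∷ []) []
                    (refute p (∧L-inconsistent s))
  ... | q , p⊑q , sφ ∷ sψ ∷ [] , [] = q , p⊑q , sφ , sψ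
  extendS (¬' φ) p s
    with extendWith p [] (φ ∷ []) [] (InΦ-sub occ-¬ (S⊆Φ p s) ∷ []) (refute p (¬L-inconsistent s))
  ... | q , p⊑q , [] , tφ ∷ [] = q , p⊑q , tφ
  extendS (φ ⊃ ψ) p s
    with extend-either p [] (φ ∷ []) (ψ ∷ []) [] [] (InΦ-sub occ-⊃ˡ (S⊆Φ p s) ∷ [])
                       (InΦ-sub occ-⊃ʳ (S⊆Φ p s) ∷ []) [] (⊃L-inconsistent s)
  ... | q , p⊑q , inj₁ ([] , tφ ∷ []) = q , p⊑q , inj₁ tφ
  ... | q , p⊑q , inj₂ (sψ ∷ [] , []) = q , p⊑q , inj₂ sψ
  extendS (∀' x φ) p s
    with extend p (λ { (z , Vz , refl) → InΦ-instance (S⊆Φ p s) Vz }) (λ ())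
                (refute p (∀L-inconsistent s))
  ... | q , p⊑q , instances⊆ , _ = q , p⊑q , λ z Vz → instances⊆ (z , Vz , refl)
  extendS ⊤'           p _ = p , ⊑-refl , tt
  extendS ⊥'           p _ = p , ⊑-refl , tt
  extendS (atom _ _ _) p _ = p , ⊑-refl , tt
  extendS (□ _)        p _ = p , ⊑-refl , tt

  extendT : ∀ ψ {W y} → W y → (p : Stage W) → FreshFor y (S p) → FreshFor y (T p) → T p ψ →
    Σ (Stage W) λ q → p ⊑ q × TClosed y (S q) (T q) ψ
  extendT (φ ∧ ψ) _ p _ _ t
    with extend-either p [] (φ ∷ []) [] (ψ ∷ []) [] (InΦ-sub occ-∧ˡ (T⊆Φ p t) ∷ [])
                       [] (InΦ-sub occ-∧ʳ (T⊆Φ p t) ∷ []) (∧R-inconsistent t)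
  ... | q , p⊑q , inj₁ ([] , tφ ∷ []) = q , p⊑q , inj₁ tφ
  ... | q , p⊑q , inj₂ ([] , tψ ∷ []) = q , p⊑q , inj₂ tψ
  extendT (¬' φ) _ p _ _ t
    with extendWith p (φ ∷ []) [] (InΦ-sub occ-¬ (T⊆Φ p t) ∷ []) [] (refute p (¬R-inconsistent t))
  ... | q , p⊑q , sφ ∷ [] , [] = q , p⊑q , sφ
  extendT (φ ⊃ ψ) _ p _ _ t
    with extendWith p (φ ∷ []) (ψ ∷ []) (InΦ-sub occ-⊃ˡ (T⊆Φ p t) ∷ []) (InΦ-sub occ-⊃ʳ (T⊆Φ p t) ∷ [])
                    (refute p (⊃R-inconsistent t))
  ... | q , p⊑q , sφ ∷ [] , tψ ∷ [] = q , p⊑q , sφ , tψ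
  extendT (∀' x φ) Wy p freshS freshT t
    with extendWith p [] (φ [ _ / x ] ∷ []) [] (InΦ-instance (T⊆Φ p t) Wy ∷ [])
                    (refute p (∀R-inconsistent freshS freshT t))
  ... | q , p⊑q , [] , tφ ∷ [] = q , p⊑q , tφ
  extendT ⊤'           _ p _ _ _ = p , ⊑-refl , tt
  extendT ⊥'           _ p _ _ _ = p , ⊑-refl , tt
  extendT (atom _ _ _) _ p _ _ _ = p , ⊑-refl , tt
  extendT (□ _)        _ p _ _ _ = p , ⊑-refl , tt

  processS : ∀ ψ {V} (p : Stage V) → Σ (Stage V) λ q → p ⊑ q × (S p ψ → SClosed V (S q) (T q) ψ)
  processS ψ p with em {S p ψ}
  ... | yes s = map₂ (map₂ const) (extendS ψ p s)
  ... | no ¬s = p , ⊑-refl , ⊥-elim ∘ ¬s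

  processT : ∀ ψ {W y} → W y → (p : Stage W) → FreshFor y (S p) → FreshFor y (T p) →
    Σ (Stage W) λ q → p ⊑ q × (T p ψ → TClosed y (S q) (T q) ψ)
  processT ψ Wy p freshS freshT with em {T p ψ}
  ... | yes t = map₂ (map₂ const) (extendT ψ Wy p freshS freshT t)
  ... | no ¬t = p , ⊑-refl , ⊥-elim ∘ ¬t

  -- The left side is processed first, so that its ∀-instances do not mention the fresh y.
  step : ∀ ψ {V W y} → V ⊆ W → W y → ¬ V y → (p : Stage V) → Σ (Stage W) (Processes y ψ p)
  step ψ V⊆W Wy ¬Vy p =
    let p₁ , p⊑p₁ , closedS = processS ψ p
        p₂ , p₁⊑p₂ , closedT = processT ψ Wy (weaken V⊆W p₁) (fresh-outside (S⊆Φ p₁) ¬Vy)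
                                                             (fresh-outside (T⊆Φ p₁) ¬Vy)
    in p₂ , ⊑-trans p⊑p₁ (⊑-trans (⊑-weaken V⊆W p₁) p₁⊑p₂) ,
       SClosed-mono ψ (λ v → v) (S-⊆ p₁⊑p₂) (T-⊆ p₁⊑p₂) ∘ closedS , closedT ∘ T-⊆ p⊑p₁

All-⋃ : ∀ {F : ℕ → FmSet} → (∀ {k m} → k ≤ m → F k ⊆ F m) →
  ∀ {Γ} → All (⋃ ℕ F) Γ → ∃ λ k → All (F k) Γ
All-⋃ mono []             = 0 , []
All-⋃ mono ((k , x) ∷ xs) with All-⋃ mono xs
... | m , ys = k ⊔ m , mono (m≤m⊔n k m) x ∷ All.map (mono (m≤n⊔m k m)) ys

closed⇒saturated : ∀ {W S T} (V : ℕ → VarSet) → FinitelyConsistent S T → S ⊆ InΦ W → T ⊆ InΦ W →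
  W ⊆ ⋃ ℕ V → (∀ {ψ} → S ψ → ∀ n → SClosed (V n) S T ψ) →
  (∀ {ψ} → T ψ → ∃ λ y → W y × TClosed y S T ψ) → Saturated W S T
closed⇒saturated V fc S⊆Φ T⊆Φ W⊆⋃V closedS closedT = record
  { consistent = fc
  ; S⊆Φ = λ _ → S⊆Φ
  ; T⊆Φ = λ _ → T⊆Φ
  ; ∧S  = λ _ _ s → closedS s 0
  ; ∧T  = λ _ _ t → proj₂ (proj₂ (closedT t))
  ; ⊃S  = λ _ _ s → closedS s 0
  ; ⊃T  = λ _ _ t → proj₂ (proj₂ (closedT t))
  ; ¬S  = λ _ s → closedS s 0
  ; ¬T  = λ _ t → proj₂ (proj₂ (closedT t))
  ; ∀S  = λ _ _ s z Wz → closedS s (proj₁ (W⊆⋃V Wz)) z (proj₂ (W⊆⋃V Wz))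
  ; ∀T  = λ _ _ → closedT
  }

module Lindenbaum (em : ExcludedMiddle 0ℓ) {U : VarSet} (co : Coinfinite U) (base : Stage U) where

  newVar : ℕ → Var
  newVar j = avoid co (2 * j)

  Used : ℕ → VarSet
  Used k = U ∪ λ x → ∃ λ j → j < k × x ≡ newVar j

  U∞ : VarSet
  U∞ = U ∪ λ x → ∃ λ j → x ≡ newVar j

  Used-mono : ∀ {k m} → k ≤ m → Used k ⊆ Used m
  Used-mono k≤m = Sum.map₂ λ (j , j<k , eq) → j , <-≤-trans j<k k≤m , eq

  Used⊆U∞ : ∀ {k} → Used k ⊆ U∞
  Used⊆U∞ = Sum.map₂ λ (j , _ , eq) → j , eq

  U∞⊆⋃Used : U∞ ⊆ ⋃ ℕ Used
  U∞⊆⋃Used (inj₁ u)        = 0 , inj₁ u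
  U∞⊆⋃Used (inj₂ (j , eq)) = suc j , inj₂ (j , ≤-refl , eq)

  newVar-fresh : ∀ k → ¬ Used k (newVar k)
  newVar-fresh k (inj₁ u)              = avoid-∉ co (2 * k) u
  newVar-fresh k (inj₂ (j , j<k , eq)) = <⇒≢ (avoid-< co (*-monoʳ-< 2 j<k)) (sym eq)

  -- newVar uses only the even positions of avoid; the odd ones witness coinfiniteness.
  coinfinite∞ : Coinfinite U∞
  coinfinite∞ n =
    avoid co (suc (2 * n)) , ≤-trans (≤-trans (m≤n*m n 2) (n≤1+n _)) (avoid-≥ co (suc (2 * n))) , λ where
    (inj₁ u)        → avoid-∉ co (suc (2 * n)) u
    (inj₂ (j , eq)) → even≢odd j n (sym (avoid-injective co eq))

  grow : ∀ k (p : Stage (Used k)) → Σ (Stage (Used (suc k))) (Processes (newVar k) (formulaAt k) p)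
  grow k = step em (formulaAt k) (Used-mono (n≤1+n k)) (inj₂ (k , ≤-refl , refl)) (newVar-fresh k)

  stage : ∀ k → Stage (Used k)
  stage zero    = weaken inj₁ base
  stage (suc k) = proj₁ (grow k (stage k))

  processed : ∀ k → Processes (newVar k) (formulaAt k) (stage k) (stage (suc k))
  processed k = proj₂ (grow k (stage k))

  stage-mono : ∀ {k m} → k ≤ m → stage k ⊑ stage m
  stage-mono = mono′ ∘ ≤⇒≤′
    where
    mono′ : ∀ {k m} → k ≤′ m → stage k ⊑ stage m
    mono′ ≤′-refl            = ⊑-refl
    mono′ (≤′-step {m} k≤′m) = ⊑-trans (mono′ k≤′m) (proj₁ (processed m))

  S∞ T∞ : FmSet
  S∞ = ⋃ ℕ (S ∘ stage)
  T∞ = ⋃ ℕ (T ∘ stage)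

  consistent∞ : FinitelyConsistent S∞ T∞
  consistent∞ Γ Δ sΓ tΔ with All-⋃ (S-⊆ ∘ stage-mono) sΓ | All-⋃ (T-⊆ ∘ stage-mono) tΔ
  ... | k , sΓ' | m , tΔ' =
    consistent (stage (k ⊔ m)) Γ Δ (All.map (S-⊆ (stage-mono (m≤m⊔n k m))) sΓ')
                                   (All.map (T-⊆ (stage-mono (m≤n⊔m k m))) tΔ')

  S∞-closed : ∀ {ψ} → S∞ ψ → ∀ n → SClosed (Used n) S∞ T∞ ψ
  S∞-closed {ψ} (k , s) n with formulaAt-recurrent ψ (n ⊔ k)
  ... | m , n⊔k≤m , refl =
    SClosed-mono (formulaAt m) (Used-mono (≤-trans (m≤m⊔n n k) n⊔k≤m)) (suc m ,_) (suc m ,_)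
      (proj₁ (proj₂ (processed m)) (S-⊆ (stage-mono (≤-trans (m≤n⊔m n k) n⊔k≤m)) s))

  T∞-closed : ∀ {ψ} → T∞ ψ → ∃ λ y → U∞ y × TClosed y S∞ T∞ ψ
  T∞-closed {ψ} (k , t) with formulaAt-recurrent ψ k
  ... | m , k≤m , refl =
    newVar m , inj₂ (m , refl) ,
    TClosed-mono (formulaAt m) (suc m ,_) (suc m ,_)
      (proj₂ (proj₂ (processed m)) (T-⊆ (stage-mono k≤m) t))

  saturated∞ : Saturated U∞ S∞ T∞
  saturated∞ =
    closed⇒saturated Used consistent∞ (λ (k , s) → InΦ-mono Used⊆U∞ (S⊆Φ (stage k) s))
                                      (λ (k , t) → InΦ-mono Used⊆U∞ (T⊆Φ (stage k) t))
                     U∞⊆⋃Used S∞-closed T∞-closed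

lindenbaum : ExcludedMiddle 0ℓ → ∀ {U} → Coinfinite U → (p : Stage U) →
  Σ VarSet λ U' → Σ FmSet λ S' → Σ FmSet λ T' →
    Coinfinite U' × Saturated U' S' T' × U ⊆ U' × S p ⊆ S' × T p ⊆ T'
lindenbaum em co p = U∞ , S∞ , T∞ , coinfinite∞ , saturated∞ , inj₁ , (0 ,_) , (0 ,_)
  where open Lindenbaum em co p

□⁻¹ : FmSet → FmSet
□⁻¹ S ψ = S (□ ψ)

□[_] : FmSet → FmSet
□[ A ] χ = ∃ λ ψ → A ψ × χ ≡ □ ψ

All-□[] : ∀ {A X} → All □[ A ] X → ∃ λ G → All A G × X ≡ map □_ G
All-□[] []                   = [] , [] , refl
All-□[] ((ψ , a , refl) ∷ as) with All-□[] as
... | G , aG , refl = ψ ∷ G , a ∷ aG , refl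

box-consistent : ∀ {S T φ} → FinitelyConsistent S T → T (□ φ) →
  FinitelyConsistent (□⁻¹ S ∪ □[ □⁻¹ S ]) ｛ φ ｝
box-consistent fc □φ∈T Λ Ξ sΛ φΞ d with partition-∪ Λ sΛ
... | D , X , sD , boxed , Λ⊆ with All-□[] boxed
... | G , sG , refl =
  fc (map □_ G ++ map □_ D) (_ ∷ []) (All-++ (map⁺ sG) (map⁺ sD)) (□φ∈T ∷ [])
     (box {Γ = G} {Δ = D} (wk Λ⊆ (λ m → here (sym (All.lookup φΞ m))) d))

boxStage : ∀ {U S T φ} → Saturated U S T → T (□ φ) → Stage U
boxStage {S = S₀} {φ = φ} sat □φ∈T = record
  { S = □⁻¹ S₀ ∪ □[ □⁻¹ S₀ ]
  ; T = ｛ φ ｝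
  ; consistent = box-consistent (Saturated.consistent sat) □φ∈T
  ; S⊆Φ = [ InΦ-sub occ-□ ∘ Saturated.S⊆Φ sat _ , (λ { (_ , s , refl) → Saturated.S⊆Φ sat _ s }) ]′
  ; T⊆Φ = λ { refl → InΦ-sub occ-□ (Saturated.T⊆Φ sat _ □φ∈T) }
  }

theorem7 : ExcludedMiddle 0ℓ →
    (U : VarSet) → Coinfinite U →
    (S T : FmSet) → Saturated U S T → GLPair S T →
    (φ : Fm) → T (□ φ) →
    Σ VarSet λ U' → Σ FmSet λ S' → Σ FmSet λ T' →
      Coinfinite U' × Saturated U' S' T' × GLPair S' T' ×
      (∀ x → U x → U' x) × T' φ ×
      (∀ ψ → S (□ ψ) → S' ψ × S' (□ ψ))
theorem7 em U co S T sat (_ , n , □¬◇ⁿ⊤∈S) φ □φ∈T with lindenbaum em co (boxStage sat □φ∈T)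
... | U' , S' , T' , co' , sat' , U⊆U' , S₀⊆S' , T₀⊆T' =
  U' , S' , T' , co' , sat' ,
  (Saturated.consistent sat' , n , S₀⊆S' (inj₂ (_ , □¬◇ⁿ⊤∈S , refl))) ,
  (λ _ → U⊆U') , T₀⊆T' refl ,
  λ ψ □ψ∈S → S₀⊆S' (inj₁ □ψ∈S) , S₀⊆S' (inj₂ (ψ , □ψ∈S , refl))
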